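{- Let $P_3(x)=\prod_{k\geq 0}(1-x^{3^k})\in\mathbb{Z}[[x]]$. Then for every positive integer $n$, $H_n(P_3)\equiv (-1)^{n-1}\pmod 3$.
   Context: For a power series $f=\sum_{i\ge0}a_ix^i$, the Hankel determinant $H_n(f)$ ($n\ge1$) is the determinant of the $n\times n$ matrix $(a_{i+j})_{0\le i,j\le n-1}$, and $H_0(f)=1$. -}

module Defs where

open import Data.Nat using (ℕ; zero; suc; _∸_; _≟_)
import Data.Nat as ℕ
open import Data.Integer using (ℤ; +_; -_; _+_; _*_; _^_; 1ℤ; 0ℤ; -1ℤ)
open import Data.Fin using (Fin; zero; suc; toℕ; punchIn)
open import Relation.Nullary using (yes; no)

Series : Set
Series = ℕ → ℤ

sumTo : ℕ → (ℕ → ℤ) → ℤ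
sumTo zero    f = 0ℤ
sumTo (suc n) f = sumTo n f + f n

_⊛_ : Series → Series → Series
(f ⊛ g) n = sumTo (suc n) (λ i → f i * g (n ∸ i))

one : Series
one zero    = 1ℤ
one (suc _) = 0ℤ

factor : ℕ → Series
factor k i with i ≟ 0 | i ≟ (3 ℕ.^ k)
... | yes _ | _     = 1ℤ
... | no _  | yes _ = -1ℤ
... | no _  | no _  = 0ℤ

prodFactors : ℕ → Series
prodFactors zero    = one
prodFactors (suc K) = prodFactors K ⊛ factor K

-- P₃ = ∏_{k≥0} (1 - x^(3^k)).  The i-th coefficient of the infinite product
-- equals that of the partial product over k < i+1, since 3^k > i for k ≥ i+1
-- and those factors are ≡ 1 mod x^(i+1).
P₃ : Series
P₃ i = prodFactors (suc i) i

sumFin : ∀ {n} → (Fin n → ℤ) → ℤ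
sumFin {zero}  f = 0ℤ
sumFin {suc n} f = f zero + sumFin (λ j → f (suc j))

det : (n : ℕ) → (Fin n → Fin n → ℤ) → ℤ
det zero    M = 1ℤ
det (suc n) M =
  sumFin (λ j → ((-1ℤ) ^ toℕ j) * (M zero j * det n (λ r c → M (suc r) (punchIn j c))))

Hankel : ℕ → Series → ℤ
Hankel n f = det n (λ i j → f (toℕ i ℕ.+ toℕ j))

-- Modulo 3 we have 1 - x^(3^k) ≡ (1 - x)^(3^k), so P₃ behaves like (1 - x)^(1 + 3 + 9 + ⋯), that is
-- (1 - x)^(-1/2) 3-adically, which is ≡ (1 - 4x)^(-1/2) = ∑ (2m choose m) xᵐ. Concretely, the m-th
-- coefficient of P₃ is ≡ the constant term c_m of (x⁻¹ + 2 + x)^m: on the blocks [0, 3^K),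
-- [3^K, 2·3^K), [2·3^K, 3^(K+1)) both follow the pattern c, -c, 0, because
-- (x⁻¹ + 2 + x)^(3^K) ≡ x^(-3^K) + 2 + x^(3^K) modulo 3.
-- The Hankel matrix (c_{i+j}) equals L · diag(1, 2, 2, …) · Lᵀ, where L, made of the coefficients of
-- the powers of x⁻¹ + 2 + x, is lower unitriangular. Hence H_n(c) = 2^(n-1) ≡ (-1)^(n-1).

module Submission where

open import Defs
open import Data.Nat using (ℕ; zero; suc; _≤_; _<_; _≥_; _∸_; z≤n; s≤s)
import Data.Nat as ℕ
import Data.Nat.Properties as ℕₚ
open import Data.Integer using (ℤ; +_; -[1+_]; _+_; _-_; _*_; -_; _^_; ∣_∣; 0ℤ; 1ℤ; -1ℤ)
import Data.Integer.Properties as ℤₚ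
open import Data.Integer.Divisibility using (_∣_)
open import Data.Integer.Divisibility.Signed as Signed
  using (divides; ∣m∣n⇒∣m+n; ∣m⇒∣-m; ∣n⇒∣m*n; ∣m⇒∣m*n; ∣⇒∣ᵤ)
open import Data.Integer.Tactic.RingSolver using (solve-∀)
open import Data.Fin using (Fin; zero; suc; toℕ; punchIn; lift)
import Data.Fin as Fin
open import Data.Fin.Properties using (suc-injective; toℕ<n)
open import Data.Empty using (⊥-elim)
open import Data.Sum using (inj₁; inj₂)
open import Function using (_∘_)
open import Algebra.Properties.AbelianGroup ℤₚ.+-0-abelianGroup using (inverseʳ-unique)
open import Relation.Nullary using (yes; no)
open import Relation.Binary.Bundles using (Setoid)
open import Relation.Binary.PropositionalEquality
import Relation.Binary.Reasoning.Setoid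

-- Finite sums

sumFin-cong : ∀ {n} {f g : Fin n → ℤ} → (∀ j → f j ≡ g j) → sumFin f ≡ sumFin g
sumFin-cong {zero}  f≡g = refl
sumFin-cong {suc n} f≡g = cong₂ _+_ (f≡g zero) (sumFin-cong (f≡g ∘ suc))

sumFin-zero : ∀ {n} {f : Fin n → ℤ} → (∀ j → f j ≡ 0ℤ) → sumFin f ≡ 0ℤ
sumFin-zero {zero}  f≡0 = refl
sumFin-zero {suc n} f≡0 = cong₂ _+_ (f≡0 zero) (sumFin-zero (f≡0 ∘ suc))

sumFin-+ : ∀ {n} (f g : Fin n → ℤ) → sumFin (λ j → f j + g j) ≡ sumFin f + sumFin g
sumFin-+ {zero}  f g = refl
sumFin-+ {suc n} f g =
  trans (cong (_+_ (f zero + g zero)) (sumFin-+ (f ∘ suc) (g ∘ suc)))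
        (interchange (f zero) (g zero) (sumFin (f ∘ suc)) (sumFin (g ∘ suc)))
  where
  interchange : ∀ a b c d → a + b + (c + d) ≡ a + c + (b + d)
  interchange = solve-∀

sumFin-*ˡ : ∀ {n} a (f : Fin n → ℤ) → sumFin (λ j → a * f j) ≡ a * sumFin f
sumFin-*ˡ {zero}  a f = sym (ℤₚ.*-zeroʳ a)
sumFin-*ˡ {suc n} a f =
  trans (cong (_+_ (a * f zero)) (sumFin-*ˡ a (f ∘ suc))) (sym (ℤₚ.*-distribˡ-+ a (f zero) _))

sumFin-linear : ∀ {n} a b {f g h : Fin n → ℤ} → (∀ j → f j ≡ a * g j + b * h j) →
                sumFin f ≡ a * sumFin g + b * sumFin h
sumFin-linear a b {g = g} {h} f≡ =
  trans (sumFin-cong f≡)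
        (trans (sumFin-+ (λ j → a * g j) (λ j → b * h j)) (cong₂ _+_ (sumFin-*ˡ a g) (sumFin-*ˡ b h)))

sumTo-cong : ∀ N {f g : ℕ → ℤ} → (∀ k → k < N → f k ≡ g k) → sumTo N f ≡ sumTo N g
sumTo-cong zero    f≡g = refl
sumTo-cong (suc N) f≡g = cong₂ _+_ (sumTo-cong N (λ k k<N → f≡g k (ℕₚ.m<n⇒m<1+n k<N))) (f≡g N ℕₚ.≤-refl)

sumTo-zero : ∀ N {f : ℕ → ℤ} → (∀ k → k < N → f k ≡ 0ℤ) → sumTo N f ≡ 0ℤ
sumTo-zero zero    f≡0 = refl
sumTo-zero (suc N) f≡0 = cong₂ _+_ (sumTo-zero N (λ k k<N → f≡0 k (ℕₚ.m<n⇒m<1+n k<N))) (f≡0 N ℕₚ.≤-refl)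

sumTo-− : ∀ N (f g : ℕ → ℤ) → sumTo N (λ k → f k - g k) ≡ sumTo N f - sumTo N g
sumTo-− zero    f g = refl
sumTo-− (suc N) f g =
  trans (cong (_+ (f N - g N)) (sumTo-− N f g)) (regroup (sumTo N f) (sumTo N g) (f N) (g N))
  where
  regroup : ∀ a b c d → a - b + (c - d) ≡ a + c - (b + d)
  regroup = solve-∀

sumTo-suc : ∀ N (f : ℕ → ℤ) → sumTo (suc N) f ≡ f 0 + sumTo N (f ∘ suc)
sumTo-suc zero    f = trans (ℤₚ.+-identityˡ (f 0)) (sym (ℤₚ.+-identityʳ (f 0)))
sumTo-suc (suc N) f = trans (cong (_+ f (suc N)) (sumTo-suc N f)) (ℤₚ.+-assoc (f 0) _ _)

sumTo-reverse : ∀ N (f : ℕ → ℤ) → sumTo (suc N) f ≡ sumTo (suc N) (λ j → f (N ∸ j))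
sumTo-reverse zero    f = refl
sumTo-reverse (suc N) f = begin
  sumTo (suc (suc N)) f                                    ≡⟨ sumTo-suc (suc N) f ⟩
  f 0 + sumTo (suc N) (f ∘ suc)                            ≡⟨ cong (_+_ (f 0)) (sumTo-reverse N (f ∘ suc)) ⟩
  f 0 + sumTo (suc N) (λ j → f (suc (N ∸ j)))              ≡⟨ cong (_+_ (f 0)) (sumTo-cong (suc N) λ j j≤N →
                                                                cong f (sym (ℕₚ.+-∸-assoc 1 (ℕₚ.≤-pred j≤N)))) ⟩
  f 0 + sumTo (suc N) (λ j → f (suc N ∸ j))                ≡⟨ ℤₚ.+-comm (f 0) _ ⟩
  sumTo (suc N) (λ j → f (suc N ∸ j)) + f 0                ≡⟨ cong (λ i → sumTo (suc N) (λ j → f (suc N ∸ j)) + f i)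
                                                                (sym (ℕₚ.n∸n≡0 N)) ⟩
  sumTo (suc (suc N)) (λ j → f (suc N ∸ j))                ∎
  where open ≡-Reasoning

sumTo-zeroTail : ∀ e N (f : ℕ → ℤ) → (∀ k → N ≤ k → f k ≡ 0ℤ) → sumTo (e ℕ.+ N) f ≡ sumTo N f
sumTo-zeroTail zero    N f tail≡0 = refl
sumTo-zeroTail (suc e) N f tail≡0 =
  trans (cong₂ _+_ (sumTo-zeroTail e N f tail≡0) (tail≡0 (e ℕ.+ N) (ℕₚ.m≤n+m N e))) (ℤₚ.+-identityʳ _)

sumFin-toℕ : ∀ n (f : ℕ → ℤ) → sumFin {n} (f ∘ toℕ) ≡ sumTo n f
sumFin-toℕ zero    f = refl
sumFin-toℕ (suc n) f = trans (cong (_+_ (f 0)) (sumFin-toℕ n (f ∘ suc))) (sym (sumTo-suc n f))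

-- Congruences of integers

infix 4 _≡_mod_

-- A record rather than a synonym for m ∣ a - b, so that a and b can be inferred.
record _≡_mod_ (a b m : ℤ) : Set where
  constructor ∣-difference
  field divides-difference : m Signed.∣ a - b

open _≡_mod_

module _ {m : ℤ} where

  ≡⇒≡-mod : ∀ {a b} → a ≡ b → a ≡ b mod m
  ≡⇒≡-mod {a} refl = ∣-difference (divides 0ℤ (trans (ℤₚ.+-inverseʳ a) (sym (ℤₚ.*-zeroˡ m))))

  ≡-mod-sym : ∀ {a b} → a ≡ b mod m → b ≡ a mod m
  ≡-mod-sym {a} {b} (∣-difference p) = ∣-difference (subst (m Signed.∣_) (negate a b) (∣m⇒∣-m p))
    where
    negate : ∀ a b → - (a - b) ≡ b - a
    negate = solve-∀

  ≡-mod-trans : ∀ {a b c} → a ≡ b mod m → b ≡ c mod m → a ≡ c mod m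
  ≡-mod-trans {a} {b} {c} (∣-difference p) (∣-difference q) =
    ∣-difference (subst (m Signed.∣_) (telescope a b c) (∣m∣n⇒∣m+n p q))
    where
    telescope : ∀ a b c → a - b + (b - c) ≡ a - c
    telescope = solve-∀

  +-cong-mod : ∀ {a b c d} → a ≡ b mod m → c ≡ d mod m → a + c ≡ b + d mod m
  +-cong-mod {a} {b} {c} {d} (∣-difference p) (∣-difference q) =
    ∣-difference (subst (m Signed.∣_) (regroup a b c d) (∣m∣n⇒∣m+n p q))
    where
    regroup : ∀ a b c d → a - b + (c - d) ≡ a + c - (b + d)
    regroup = solve-∀

  *-cong-mod : ∀ {a b c d} → a ≡ b mod m → c ≡ d mod m → a * c ≡ b * d mod m
  *-cong-mod {a} {b} {c} {d} (∣-difference p) (∣-difference q) =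
    ∣-difference (subst (m Signed.∣_) (regroup a b c d) (∣m∣n⇒∣m+n (∣m⇒∣m*n c p) (∣n⇒∣m*n b q)))
    where
    regroup : ∀ a b c d → (a - b) * c + b * (c - d) ≡ a * c - b * d
    regroup = solve-∀

  neg-cong-mod : ∀ {a b} → a ≡ b mod m → - a ≡ - b mod m
  neg-cong-mod {a} {b} (∣-difference p) = ∣-difference (subst (m Signed.∣_) (negate a b) (∣m⇒∣-m p))
    where
    negate : ∀ a b → - (a - b) ≡ - a - - b
    negate = solve-∀

  +-multiple-mod : ∀ a q → a + q * m ≡ a mod m
  +-multiple-mod a q = ∣-difference (divides q (cancel a q m))
    where
    cancel : ∀ a q m → a + q * m - a ≡ q * m
    cancel = solve-∀

  ^-cong-mod : ∀ n {a b} → a ≡ b mod m → a ^ n ≡ b ^ n mod m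
  ^-cong-mod zero    a≡b = ≡⇒≡-mod refl
  ^-cong-mod (suc n) a≡b = *-cong-mod a≡b (^-cong-mod n a≡b)

  ≡-mod-setoid : Setoid _ _
  ≡-mod-setoid = record
    { Carrier       = ℤ
    ; _≈_           = λ a b → a ≡ b mod m
    ; isEquivalence = record { refl = ≡⇒≡-mod refl ; sym = ≡-mod-sym ; trans = ≡-mod-trans }
    }

  sumFin-cong-mod : ∀ {n} {f g : Fin n → ℤ} → (∀ j → f j ≡ g j mod m) → sumFin f ≡ sumFin g mod m
  sumFin-cong-mod {zero}  f≡g = ≡⇒≡-mod refl
  sumFin-cong-mod {suc n} f≡g = +-cong-mod (f≡g zero) (sumFin-cong-mod (f≡g ∘ suc))

module ≡-mod-Reasoning (m : ℤ) = Relation.Binary.Reasoning.Setoid (≡-mod-setoid {m})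

-- Determinants

sgn : ∀ {n} → Fin n → ℤ
sgn j = -1ℤ ^ toℕ j

*-zeroʳ² : ∀ s a → s * (a * 0ℤ) ≡ 0ℤ
*-zeroʳ² s a = trans (cong (s *_) (ℤₚ.*-zeroʳ a)) (ℤₚ.*-zeroʳ s)

Mat : ℕ → Set
Mat n = Fin n → Fin n → ℤ

minor : ∀ {n} → Fin (suc n) → Mat (suc n) → Mat n
minor j M r c = M (suc r) (punchIn j c)

det-cong : ∀ n {M N : Mat n} → (∀ r c → M r c ≡ N r c) → det n M ≡ det n N
det-cong zero    M≡N = refl
det-cong (suc n) M≡N = sumFin-cong λ j →
  cong₂ (λ x y → sgn j * (x * y)) (M≡N zero j) (det-cong n (λ r c → M≡N (suc r) (punchIn j c)))

det-cong-mod : ∀ {m} n {M N : Mat n} → (∀ r c → M r c ≡ N r c mod m) → det n M ≡ det n N mod m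
det-cong-mod zero    M≡N = ≡⇒≡-mod refl
det-cong-mod (suc n) M≡N = sumFin-cong-mod λ j →
  *-cong-mod (≡⇒≡-mod {a = sgn j} refl) (*-cong-mod (M≡N zero j) (det-cong-mod n (λ r c → M≡N (suc r) (punchIn j c))))

Extensional : ∀ {m k} → ((Fin m → Fin k) → ℤ) → Set
Extensional Φ = ∀ {f g} → (∀ c → f c ≡ g c) → Φ f ≡ Φ g

-- Laplace expansion along two rows u and v, where Φ f stands for the determinant of the
-- remaining rows restricted to the columns f.
expand₁ : ∀ {m} → Fin (suc (suc m)) → (Fin (suc (suc m)) → ℤ) → ((Fin m → Fin (suc (suc m))) → ℤ) → ℤ
expand₁ j v Φ = sumFin (λ k → sgn k * (v (punchIn j k) * Φ (λ c → punchIn j (punchIn k c))))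

expand₂ : ∀ {m} → (u v : Fin (suc (suc m)) → ℤ) → ((Fin m → Fin (suc (suc m))) → ℤ) → ℤ
expand₂ u v Φ = sumFin (λ j → sgn j * (u j * expand₁ j v Φ))

-- Sorting the terms of expand₂ u v Φ by which row, if any, uses column 0 exposes the
-- antisymmetry in u and v, up to the terms W avoiding column 0, which are handled by induction.
module ColumnZeroSplit {m} (Φ : (Fin m → Fin (suc (suc m))) → ℤ) where

  Φ₀₁ : ℤ
  Φ₀₁ = Φ (λ c → suc (suc c))

  Φ₀ : Fin m → ℤ
  Φ₀ k = Φ (λ c → suc (punchIn (suc k) c))

  S : (Fin (suc (suc m)) → ℤ) → ℤ
  S v = sumFin (λ k → sgn k * (v (suc (suc k)) * Φ₀ k))

  W₁ : (Fin (suc (suc m)) → ℤ) → Fin (suc m) → ℤ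
  W₁ v j = sumFin (λ k → sgn (suc k) * (v (suc (punchIn j k)) * Φ (λ c → punchIn (suc j) (punchIn (suc k) c))))

  W : (u v : Fin (suc (suc m)) → ℤ) → ℤ
  W u v = sumFin (λ j → sgn (suc j) * (u (suc j) * W₁ v j))

  sumFin-alternate : (f : Fin m → ℤ) → sumFin (λ k → (-1ℤ * sgn k) * f k) ≡ -1ℤ * sumFin (λ k → sgn k * f k)
  sumFin-alternate f = trans (sumFin-cong (λ k → ℤₚ.*-assoc -1ℤ (sgn k) (f k))) (sumFin-*ˡ -1ℤ (λ k → sgn k * f k))

  expand₁-zero : ∀ v → expand₁ zero v Φ ≡ v (suc zero) * Φ₀₁ - S v
  expand₁-zero v = trans (cong (_+_ (1ℤ * (v (suc zero) * Φ₀₁))) (sumFin-alternate (λ k → v (suc (suc k)) * Φ₀ k)))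
                         (simplify (v (suc zero) * Φ₀₁) (S v))
    where
    simplify : ∀ x s → 1ℤ * x + -1ℤ * s ≡ x - s
    simplify = solve-∀

  expand₁-suc : ∀ v j → expand₁ (suc j) v Φ ≡ v zero * Φ (λ c → suc (punchIn j c)) + W₁ v j
  expand₁-suc v j = cong (_+ W₁ v j) (ℤₚ.*-identityˡ (v zero * Φ (λ c → suc (punchIn j c))))

  columnZero-terms : ∀ (u v : Fin (suc (suc m)) → ℤ) →
                     sumFin (λ j → sgn (suc j) * (u (suc j) * (v zero * Φ (λ c → suc (punchIn j c)))))
                     ≡ v zero * (S u - u (suc zero) * Φ₀₁)
  columnZero-terms u v = begin
    -1ℤ * 1ℤ * (u (suc zero) * (v zero * Φ₀₁)) + sumFin (λ k → -1ℤ * (-1ℤ * sgn k) * (u (suc (suc k)) * (v zero * Φ₀ k)))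
      ≡⟨ cong (_+_ (-1ℤ * 1ℤ * (u (suc zero) * (v zero * Φ₀₁))))
              (trans (sumFin-cong (λ k → reorder (sgn k) (u (suc (suc k))) (v zero) (Φ₀ k)))
                     (sumFin-*ˡ (v zero) (λ k → sgn k * (u (suc (suc k)) * Φ₀ k)))) ⟩
    -1ℤ * 1ℤ * (u (suc zero) * (v zero * Φ₀₁)) + v zero * S u
      ≡⟨ collect (u (suc zero)) (v zero) Φ₀₁ (S u) ⟩
    v zero * (S u - u (suc zero) * Φ₀₁)
      ∎
    where
    open ≡-Reasoning
    reorder : ∀ s a b c → -1ℤ * (-1ℤ * s) * (a * (b * c)) ≡ b * (s * (a * c))
    reorder = solve-∀
    collect : ∀ a b c s → -1ℤ * 1ℤ * (a * (b * c)) + b * s ≡ b * (s - a * c)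
    collect = solve-∀

  expand₂-split : ∀ u v → expand₂ u v Φ ≡ u zero * (v (suc zero) * Φ₀₁ - S v)
                                          + (v zero * (S u - u (suc zero) * Φ₀₁) + W u v)
  expand₂-split u v = cong₂ _+_ (trans (ℤₚ.*-identityˡ (u zero * expand₁ zero v Φ)) (cong (u zero *_) (expand₁-zero v))) (begin
    sumFin (λ j → sgn (suc j) * (u (suc j) * expand₁ (suc j) v Φ))
      ≡⟨ sumFin-cong (λ j → trans (cong (λ x → sgn (suc j) * (u (suc j) * x)) (expand₁-suc v j))
                           (distrib (sgn (suc j)) (u (suc j)) (v zero * Φ (λ c → suc (punchIn j c))) (W₁ v j))) ⟩
    sumFin (λ j → sgn (suc j) * (u (suc j) * (v zero * Φ (λ c → suc (punchIn j c)))) + sgn (suc j) * (u (suc j) * W₁ v j))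
      ≡⟨ sumFin-+ (λ j → sgn (suc j) * (u (suc j) * (v zero * Φ (λ c → suc (punchIn j c)))))
                  (λ j → sgn (suc j) * (u (suc j) * W₁ v j)) ⟩
    sumFin (λ j → sgn (suc j) * (u (suc j) * (v zero * Φ (λ c → suc (punchIn j c))))) + W u v
      ≡⟨ cong (_+ W u v) (columnZero-terms u v) ⟩
    v zero * (S u - u (suc zero) * Φ₀₁) + W u v
      ∎)
    where
    open ≡-Reasoning
    distrib : ∀ s a x y → s * (a * (x + y)) ≡ s * (a * x) + s * (a * y)
    distrib = solve-∀

  expand₂-swap : ∀ u v → expand₂ u v Φ + expand₂ v u Φ ≡ W u v + W v u
  expand₂-swap u v =
    trans (cong₂ _+_ (expand₂-split u v) (expand₂-split v u))
          (cancel (u zero) (u (suc zero)) (v zero) (v (suc zero)) Φ₀₁ (S u) (S v) (W u v) (W v u))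
    where
    cancel : ∀ u₀ u₁ v₀ v₁ p su sv wuv wvu →
             u₀ * (v₁ * p - sv) + (v₀ * (su - u₁ * p) + wuv) + (v₀ * (u₁ * p - su) + (u₀ * (sv - v₁ * p) + wvu))
             ≡ wuv + wvu
    cancel = solve-∀

punchIn-suc-lift : ∀ {m} (j : Fin (suc (suc m))) (k : Fin (suc m)) c →
                   punchIn (suc j) (punchIn (suc k) c) ≡ lift 1 (λ c → punchIn j (punchIn k c)) c
punchIn-suc-lift j k zero    = refl
punchIn-suc-lift j k (suc c) = refl

expand₂-antisym : ∀ m (u v : Fin (suc (suc m)) → ℤ) (Φ : (Fin m → Fin (suc (suc m))) → ℤ) → Extensional Φ →
                  expand₂ u v Φ + expand₂ v u Φ ≡ 0ℤ
expand₂-antisym zero u v Φ _ = trans (expand₂-swap u v) (cong₂ _+_ (W-empty u v) (W-empty v u))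
  where
  open ColumnZeroSplit Φ
  W-empty : ∀ u v → W u v ≡ 0ℤ
  W-empty u v = sumFin-zero λ j → *-zeroʳ² (sgn (suc j)) (u (suc j))
expand₂-antisym (suc m) u v Φ Φ-ext =
  trans (expand₂-swap u v)
        (trans (cong₂ _+_ (W-tail u v) (W-tail v u)) (expand₂-antisym m (u ∘ suc) (v ∘ suc) Φ⁺ (Φ-ext ∘ lift-cong)))
  where
  open ColumnZeroSplit Φ
  Φ⁺ : (Fin m → Fin (suc (suc m))) → ℤ
  Φ⁺ f = Φ (lift 1 f)
  lift-cong : ∀ {f g : Fin m → Fin (suc (suc m))} → (∀ c → f c ≡ g c) → ∀ c → lift 1 f c ≡ lift 1 g c
  lift-cong f≡g zero    = refl
  lift-cong f≡g (suc c) = cong suc (f≡g c)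
  W₁-tail : ∀ v j → W₁ v j ≡ -1ℤ * expand₁ j (v ∘ suc) Φ⁺
  W₁-tail v j = trans (sumFin-cong λ k →
      trans (cong (λ x → sgn (suc k) * (v (suc (punchIn j k)) * x)) (Φ-ext (punchIn-suc-lift j k)))
            (ℤₚ.*-assoc -1ℤ (sgn k) _))
    (sumFin-*ˡ -1ℤ (λ k → sgn k * (v (suc (punchIn j k)) * Φ⁺ (λ c → punchIn j (punchIn k c)))))
  W-tail : ∀ u v → W u v ≡ expand₂ (u ∘ suc) (v ∘ suc) Φ⁺
  W-tail u v = sumFin-cong λ j →
    trans (cong (λ x → sgn (suc j) * (u (suc j) * x)) (W₁-tail v j)) (signs (sgn j) (u (suc j)) _)
    where
    signs : ∀ s a x → -1ℤ * s * (a * (-1ℤ * x)) ≡ s * (a * x)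
    signs = solve-∀

swap₀₁ : ∀ {n} → Mat (suc (suc n)) → Mat (suc (suc n))
swap₀₁ M zero          = M (suc zero)
swap₀₁ M (suc zero)    = M zero
swap₀₁ M (suc (suc r)) = M (suc (suc r))

det-swap₀₁ : ∀ n (M : Mat (suc (suc n))) → det (suc (suc n)) M ≡ - det (suc (suc n)) (swap₀₁ M)
det-swap₀₁ n M = inverseʳ-unique _ _
  (expand₂-antisym n (M (suc zero)) (M zero) (λ f → det n (λ r c → M (suc (suc r)) (f c)))
                     (λ f≡g → det-cong n (λ r c → cong (M (suc (suc r))) (f≡g c))))

x≡-x⇒x≡0 : ∀ {x} → x ≡ - x → x ≡ 0ℤ
x≡-x⇒x≡0 {+ zero}   _  = refl
x≡-x⇒x≡0 {+ suc _}  ()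
x≡-x⇒x≡0 { -[1+ _ ]} ()

mutual
  det-equalRows : ∀ n (M : Mat n) {r s : Fin n} → r Fin.< s → (∀ c → M r c ≡ M s c) → det n M ≡ 0ℤ
  det-equalRows (suc (suc n)) M {zero} {suc zero} _ M₀≡M₁ =
    x≡-x⇒x≡0 (trans (det-swap₀₁ n M) (cong -_ (det-cong (suc (suc n)) swap≡)))
    where
    swap≡ : ∀ r c → swap₀₁ M r c ≡ M r c
    swap≡ zero          c = sym (M₀≡M₁ c)
    swap≡ (suc zero)    c = M₀≡M₁ c
    swap≡ (suc (suc r)) c = refl
  det-equalRows (suc (suc n)) M {zero} {suc (suc s)} _ M₀≡Mₛ =
    trans (det-swap₀₁ n M) (cong -_ (det-equalRows-suc (suc n) (swap₀₁ M) {zero} {suc s} (s≤s z≤n) M₀≡Mₛ))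
  det-equalRows (suc n) M {suc r} {suc s} (s≤s r<s) Mᵣ≡Mₛ = det-equalRows-suc n M r<s Mᵣ≡Mₛ

  det-equalRows-suc : ∀ n (M : Mat (suc n)) {r s : Fin n} → r Fin.< s →
                      (∀ c → M (suc r) c ≡ M (suc s) c) → det (suc n) M ≡ 0ℤ
  det-equalRows-suc n M r<s Mᵣ≡Mₛ = sumFin-zero λ j →
    trans (cong (λ x → sgn j * (M zero j * x)) (det-equalRows n (minor j M) r<s (Mᵣ≡Mₛ ∘ punchIn j)))
          (*-zeroʳ² (sgn j) (M zero j))

det-linear-row : ∀ n (i : Fin n) (M A B : Mat n) (a b : ℤ) →
                 (∀ r c → r ≢ i → M r c ≡ A r c) → (∀ r c → r ≢ i → B r c ≡ A r c) →
                 (∀ c → M i c ≡ a * A i c + b * B i c) → det n M ≡ a * det n A + b * det n B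
det-linear-row (suc n) zero M A B a b M≡A B≡A Mᵢ≡ = sumFin-linear a b λ j → begin
  sgn j * (M zero j * det n (minor j M))
    ≡⟨ cong₂ (λ x y → sgn j * (x * y)) (Mᵢ≡ j) (det-cong n (λ r c → M≡A (suc r) (punchIn j c) (λ ()))) ⟩
  sgn j * ((a * A zero j + b * B zero j) * det n (minor j A))
    ≡⟨ distrib (sgn j) a b (A zero j) (B zero j) (det n (minor j A)) ⟩
  a * (sgn j * (A zero j * det n (minor j A))) + b * (sgn j * (B zero j * det n (minor j A)))
    ≡⟨ cong (λ y → a * (sgn j * (A zero j * det n (minor j A))) + b * (sgn j * (B zero j * y)))
            (det-cong n (λ r c → sym (B≡A (suc r) (punchIn j c) (λ ())))) ⟩
  a * (sgn j * (A zero j * det n (minor j A))) + b * (sgn j * (B zero j * det n (minor j B)))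
    ∎
  where
  open ≡-Reasoning
  distrib : ∀ s a b x y d → s * ((a * x + b * y) * d) ≡ a * (s * (x * d)) + b * (s * (y * d))
  distrib = solve-∀
det-linear-row (suc n) (suc i) M A B a b M≡A B≡A Mᵢ≡ = sumFin-linear a b λ j → begin
  sgn j * (M zero j * det n (minor j M))
    ≡⟨ cong₂ (λ x y → sgn j * (x * y)) (M≡A zero j (λ ()))
             (det-linear-row n i (minor j M) (minor j A) (minor j B) a b
                (λ r c r≢i → M≡A (suc r) (punchIn j c) (r≢i ∘ suc-injective))
                (λ r c r≢i → B≡A (suc r) (punchIn j c) (r≢i ∘ suc-injective))
                (Mᵢ≡ ∘ punchIn j)) ⟩
  sgn j * (A zero j * (a * det n (minor j A) + b * det n (minor j B)))
    ≡⟨ distrib (sgn j) a b (A zero j) (det n (minor j A)) (det n (minor j B)) ⟩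
  a * (sgn j * (A zero j * det n (minor j A))) + b * (sgn j * (A zero j * det n (minor j B)))
    ≡⟨ cong (λ x → a * (sgn j * (A zero j * det n (minor j A))) + b * (sgn j * (x * det n (minor j B))))
            (sym (B≡A zero j (λ ()))) ⟩
  a * (sgn j * (A zero j * det n (minor j A))) + b * (sgn j * (B zero j * det n (minor j B)))
    ∎
  where
  open ≡-Reasoning
  distrib : ∀ s a b x d e → s * (x * (a * d + b * e)) ≡ a * (s * (x * d)) + b * (s * (x * e))
  distrib = solve-∀

+-multiple-of-0 : ∀ x {d} y → d ≡ 0ℤ → x + d * y ≡ x
+-multiple-of-0 x y refl = trans (cong (_+_ x) (ℤₚ.*-zeroˡ y)) (ℤₚ.+-identityʳ x)

mutual
  det-addRowMultiples : ∀ n (H H′ : Mat n) (p : Fin n) (d : Fin n → ℤ) → d p ≡ 0ℤ →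
                        (∀ i c → H′ i c ≡ H i c + d i * H p c) → det n H′ ≡ det n H
  det-addRowMultiples (suc n) H H′ (suc p) d dₚ≡0 H′≡ = det-addRowMultiples-suc n H H′ p d dₚ≡0 H′≡
  det-addRowMultiples (suc zero) H H′ zero d d₀≡0 H′≡ =
    det-cong 1 {H′} {H} λ { zero c → trans (H′≡ zero c) (+-multiple-of-0 (H zero c) (H zero c) d₀≡0) }
  det-addRowMultiples (suc (suc n)) H H′ zero d d₀≡0 H′≡ =
    trans (det-swap₀₁ n H′)
          (trans (cong -_ (det-addRowMultiples-suc (suc n) (swap₀₁ H) (swap₀₁ H′) zero d′ refl swapped≡))
                 (sym (det-swap₀₁ n H)))
    where
    d′ : Fin (suc (suc n)) → ℤ
    d′ zero          = d (suc zero)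
    d′ (suc zero)    = 0ℤ
    d′ (suc (suc r)) = d (suc (suc r))
    swapped≡ : ∀ i c → swap₀₁ H′ i c ≡ swap₀₁ H i c + d′ i * swap₀₁ H (suc zero) c
    swapped≡ zero          c = H′≡ (suc zero) c
    swapped≡ (suc zero)    c = trans (H′≡ zero c)
                                     (trans (+-multiple-of-0 (H zero c) (H zero c) d₀≡0)
                                            (sym (+-multiple-of-0 (H zero c) (H zero c) refl)))
    swapped≡ (suc (suc r)) c = H′≡ (suc (suc r)) c

  -- Row 0 is split by linearity into its own part, handled in the minors, and a multiple of
  -- row p, which vanishes as a repeated row.
  det-addRowMultiples-suc : ∀ n (H H′ : Mat (suc n)) (p : Fin n) (d : Fin (suc n) → ℤ) → d (suc p) ≡ 0ℤ →
                            (∀ i c → H′ i c ≡ H i c + d i * H (suc p) c) → det (suc n) H′ ≡ det (suc n) H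
  det-addRowMultiples-suc n H H′ p d dₚ≡0 H′≡ = begin
    det (suc n) H′                              ≡⟨ det-linear-row (suc n) zero H′ H₀ Hₚ 1ℤ (d zero)
                                                     (λ { zero _ 0≢0 → ⊥-elim (0≢0 refl) ; (suc r) c _ → refl })
                                                     (λ { zero _ 0≢0 → ⊥-elim (0≢0 refl) ; (suc r) c _ → refl })
                                                     (λ c → trans (H′≡ zero c) (cong (_+ d zero * H (suc p) c)
                                                                               (sym (ℤₚ.*-identityˡ (H zero c))))) ⟩
    1ℤ * det (suc n) H₀ + d zero * det (suc n) Hₚ ≡⟨ cong₂ (λ x y → 1ℤ * x + d zero * y) H₀-det Hₚ-det ⟩
    1ℤ * det (suc n) H + d zero * 0ℤ              ≡⟨ simplify (det (suc n) H) (d zero) ⟩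
    det (suc n) H                                ∎
    where
    open ≡-Reasoning
    H₀ Hₚ : Mat (suc n)
    H₀ zero    = H zero
    H₀ (suc r) = H′ (suc r)
    Hₚ zero    = H (suc p)
    Hₚ (suc r) = H′ (suc r)
    H₀-det : det (suc n) H₀ ≡ det (suc n) H
    H₀-det = sumFin-cong λ j → cong (λ x → sgn j * (H zero j * x))
      (det-addRowMultiples n (minor j H) (minor j H₀) p (d ∘ suc) dₚ≡0 (λ r c → H′≡ (suc r) (punchIn j c)))
    Hₚ-det : det (suc n) Hₚ ≡ 0ℤ
    Hₚ-det = det-equalRows (suc n) Hₚ {zero} {suc p} (s≤s z≤n) λ c →
      sym (trans (H′≡ (suc p) c) (+-multiple-of-0 (H (suc p) c) (H (suc p) c) dₚ≡0))
    simplify : ∀ x y → 1ℤ * x + y * 0ℤ ≡ x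
    simplify = solve-∀

det-unitriangular-* : ∀ n (L X H : Mat n) → (∀ i → L i i ≡ 1ℤ) → (∀ i k → i Fin.< k → L i k ≡ 0ℤ) →
                      (∀ i c → H i c ≡ sumFin (λ k → L i k * X k c)) → det n H ≡ det n X
det-unitriangular-* zero    L X H _    _     _     = refl
det-unitriangular-* (suc n) L X H diag upper H≡LX =
  trans (sym (det-addRowMultiples (suc n) H H′ zero d refl (λ _ _ → refl)))
        (sumFin-cong λ j → cong₂ (λ x y → sgn j * (x * y)) (H′₀≡X₀ j)
          (det-unitriangular-* n (λ r k → L (suc r) (suc k)) (minor j X) (minor j H′)
             (diag ∘ suc) (λ i k i<k → upper (suc i) (suc k) (s≤s i<k)) (λ r c → minor≡ r (punchIn j c))))
  where
  d : Fin (suc n) → ℤ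
  d zero    = 0ℤ
  d (suc i) = - L (suc i) zero
  H′ : Mat (suc n)
  H′ i c = H i c + d i * H zero c
  H₀≡X₀ : ∀ c → H zero c ≡ X zero c
  H₀≡X₀ c = begin
    H zero c
      ≡⟨ H≡LX zero c ⟩
    L zero zero * X zero c + sumFin (λ k → L zero (suc k) * X (suc k) c)
      ≡⟨ cong₂ (λ x y → x * X zero c + y) (diag zero) (sumFin-zero λ k →
           trans (cong (_* X (suc k) c) (upper zero (suc k) (s≤s z≤n))) (ℤₚ.*-zeroˡ (X (suc k) c))) ⟩
    1ℤ * X zero c + 0ℤ
      ≡⟨ trans (ℤₚ.+-identityʳ _) (ℤₚ.*-identityˡ _) ⟩
    X zero c
      ∎
    where open ≡-Reasoning
  H′₀≡X₀ : ∀ c → H′ zero c ≡ X zero c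
  H′₀≡X₀ c = trans (+-multiple-of-0 (H zero c) (H zero c) refl) (H₀≡X₀ c)
  minor≡ : ∀ r c → H′ (suc r) c ≡ sumFin (λ k → L (suc r) (suc k) * X (suc k) c)
  minor≡ r c = trans (cong₂ (λ x y → x + - L (suc r) zero * y) (H≡LX (suc r) c) (H₀≡X₀ c))
                     (cancel (L (suc r) zero) (X zero c) (sumFin (λ k → L (suc r) (suc k) * X (suc k) c)))
    where
    cancel : ∀ a x s → (a * x + s) + - a * x ≡ s
    cancel = solve-∀

prodFin : ∀ {n} → (Fin n → ℤ) → ℤ
prodFin {zero}  f = 1ℤ
prodFin {suc n} f = f zero * prodFin (f ∘ suc)

det-zeroColumn₀ : ∀ n (M : Mat (suc n)) → (∀ r → M r zero ≡ 0ℤ) → det (suc n) M ≡ 0ℤ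
det-zeroColumn₀ zero    M col≡0 = cong (λ x → 1ℤ * (x * 1ℤ) + 0ℤ) (col≡0 zero)
det-zeroColumn₀ (suc n) M col≡0 = sumFin-zero term
  where
  term : ∀ j → sgn j * (M zero j * det (suc n) (minor j M)) ≡ 0ℤ
  term zero    = trans (cong (λ x → 1ℤ * (x * det (suc n) (minor zero M))) (col≡0 zero))
                       (vanish₀ (det (suc n) (minor zero M)))
    where
    vanish₀ : ∀ y → 1ℤ * (0ℤ * y) ≡ 0ℤ
    vanish₀ = solve-∀
  term (suc j) = trans (cong (λ x → sgn (suc j) * (M zero (suc j) * x)) (det-zeroColumn₀ n (minor (suc j) M) (col≡0 ∘ suc)))
                       (*-zeroʳ² (sgn (suc j)) (M zero (suc j)))

det-zeroBelow₀ : ∀ n (M : Mat (suc n)) → (∀ r → M (suc r) zero ≡ 0ℤ) → det (suc n) M ≡ M zero zero * det n (minor zero M)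
det-zeroBelow₀ zero    M _     = trans (ℤₚ.+-identityʳ _) (ℤₚ.*-identityˡ _)
det-zeroBelow₀ (suc n) M col≡0 =
  trans (cong (_+_ (1ℤ * (M zero zero * det (suc n) (minor zero M))))
              (sumFin-zero λ j → trans (cong (λ x → sgn (suc j) * (M zero (suc j) * x))
                                             (det-zeroColumn₀ n (minor (suc j) M) col≡0))
                                       (*-zeroʳ² (sgn (suc j)) (M zero (suc j)))))
        (trans (ℤₚ.+-identityʳ _) (ℤₚ.*-identityˡ _))

det-upperTriangular : ∀ n (M : Mat n) → (∀ r c → c Fin.< r → M r c ≡ 0ℤ) → det n M ≡ prodFin (λ i → M i i)
det-upperTriangular zero    M _     = refl
det-upperTriangular (suc n) M lower≡0 =
  trans (det-zeroBelow₀ n M (λ r → lower≡0 (suc r) zero (s≤s z≤n)))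
        (cong (M zero zero *_) (det-upperTriangular n (minor zero M) (λ r c c<r → lower≡0 (suc r) (suc c) (s≤s c<r))))

-- The central coefficients

-- A function ℤ → ℤ is the coefficient sequence of a Laurent series; Q a f is (x⁻ᵃ + 2 + xᵃ) · f.
Q : ℤ → (ℤ → ℤ) → ℤ → ℤ
Q a f k = f (k - a) + + 2 * f k + f (k + a)

Qⁿ : ℕ → (ℤ → ℤ) → ℤ → ℤ
Qⁿ zero    f = f
Qⁿ (suc n) f = Q 1ℤ (Qⁿ n f)

δ₀ : ℤ → ℤ
δ₀ (+ zero)  = 1ℤ
δ₀ (+ suc _) = 0ℤ
δ₀ -[1+ _ ]  = 0ℤ

Qpow : ℕ → ℤ → ℤ
Qpow i = Qⁿ i δ₀

-- Since x⁻¹ + 2 + x = x⁻¹ (1 + x)², central i is the binomial coefficient (2i choose i).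
central : ℕ → ℤ
central i = Qpow i 0ℤ

Qpow-even : ∀ i k → Qpow i (- k) ≡ Qpow i k
Qpow-even zero    (+ zero)  = refl
Qpow-even zero    (+ suc _) = refl
Qpow-even zero    -[1+ _ ]  = refl
Qpow-even (suc i) k = begin
  Qpow i (- k - 1ℤ) + + 2 * Qpow i (- k) + Qpow i (- k + 1ℤ)
    ≡⟨ cong₂ (λ x y → x + + 2 * Qpow i (- k) + y)
             (trans (cong (Qpow i) (neg-+ k)) (Qpow-even i (k + 1ℤ)))
             (trans (cong (Qpow i) (neg-− k)) (Qpow-even i (k - 1ℤ))) ⟩
  Qpow i (k + 1ℤ) + + 2 * Qpow i (- k) + Qpow i (k - 1ℤ)
    ≡⟨ cong (λ x → Qpow i (k + 1ℤ) + + 2 * x + Qpow i (k - 1ℤ)) (Qpow-even i k) ⟩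
  Qpow i (k + 1ℤ) + + 2 * Qpow i k + Qpow i (k - 1ℤ)
    ≡⟨ swap-ends (Qpow i (k - 1ℤ)) (Qpow i k) (Qpow i (k + 1ℤ)) ⟩
  Qpow i (k - 1ℤ) + + 2 * Qpow i k + Qpow i (k + 1ℤ)
    ∎
  where
  open ≡-Reasoning
  neg-+ : ∀ k → - k - 1ℤ ≡ - (k + 1ℤ)
  neg-+ = solve-∀
  neg-− : ∀ k → - k + 1ℤ ≡ - (k - 1ℤ)
  neg-− = solve-∀
  swap-ends : ∀ a b c → c + + 2 * b + a ≡ a + + 2 * b + c
  swap-ends = solve-∀

Qpow-support : ∀ i k → i < ∣ k ∣ → Qpow i k ≡ 0ℤ
Qpow-support zero    (+ suc _) _   = refl
Qpow-support zero    -[1+ _ ]  _   = refl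
Qpow-support (suc i) k         i<k =
  trans (cong₂ (λ x y → x + + 2 * Qpow i k + y)
               (Qpow-support i (k - 1ℤ) (neighbour -1ℤ refl)) (Qpow-support i (k + 1ℤ) (neighbour 1ℤ refl)))
        (cong (λ z → 0ℤ + + 2 * z + 0ℤ) (Qpow-support i k (ℕₚ.<-trans (ℕₚ.n<1+n i) i<k)))
  where
  neighbour : ∀ e → ∣ - e ∣ ≡ 1 → i < ∣ k + e ∣
  neighbour e ∣-e∣≡1 = ℕₚ.≤-pred (begin
    suc (suc i)           ≤⟨ i<k ⟩
    ∣ k ∣                 ≡⟨ cong ∣_∣ (cancel k e) ⟨
    ∣ k + e + - e ∣       ≤⟨ ℤₚ.∣i+j∣≤∣i∣+∣j∣ (k + e) (- e) ⟩
    ∣ k + e ∣ ℕ.+ ∣ - e ∣ ≡⟨ cong (∣ k + e ∣ ℕ.+_) ∣-e∣≡1 ⟩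
    ∣ k + e ∣ ℕ.+ 1       ≡⟨ ℕₚ.+-comm ∣ k + e ∣ 1 ⟩
    suc ∣ k + e ∣         ∎)
    where
    open ℕₚ.≤-Reasoning
    cancel : ∀ k e → k + e + - e ≡ k
    cancel = solve-∀

+suc-1≡+ : ∀ a → + suc a - 1ℤ ≡ + a
+suc-1≡+ a = cancel (+ a)
  where
  cancel : ∀ x → 1ℤ + x - 1ℤ ≡ x
  cancel = solve-∀

++1≡+suc : ∀ a → + a + 1ℤ ≡ + suc a
++1≡+suc a = cong +_ (ℕₚ.+-comm a 1)

Qpow-top : ∀ i → Qpow i (+ i) ≡ 1ℤ
Qpow-top zero    = refl
Qpow-top (suc i) =
  trans (cong₂ (λ x y → x + + 2 * Qpow i (+ suc i) + y)
               (trans (cong (Qpow i) (+suc-1≡+ i)) (Qpow-top i))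
               (Qpow-support i (+ suc i + 1ℤ) (subst (i <_) (cong ∣_∣ (sym (++1≡+suc (suc i)))) (ℕₚ.m<n+m i (s≤s z≤n)))))
        (cong (λ z → 1ℤ + + 2 * z + 0ℤ) (Qpow-support i (+ suc i) (ℕₚ.n<1+n i)))

-- Q 1ℤ acting on an even sequence, written in terms of its values on ℕ.
Q₊ : (ℕ → ℤ) → ℕ → ℤ
Q₊ a zero    = + 2 * a 0 + + 2 * a 1
Q₊ a (suc k) = a k + + 2 * a (suc k) + a (suc (suc k))

Qpow-suc : ∀ i k → Qpow (suc i) (+ k) ≡ Q₊ (λ k → Qpow i (+ k)) k
Qpow-suc i zero    = trans (cong (λ x → x + + 2 * Qpow i 0ℤ + Qpow i 1ℤ) (Qpow-even i 1ℤ))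
                           (double (Qpow i 0ℤ) (Qpow i 1ℤ))
  where
  double : ∀ a b → b + + 2 * a + b ≡ + 2 * a + + 2 * b
  double = solve-∀
Qpow-suc i (suc k) = cong₂ (λ x y → x + + 2 * Qpow i (+ suc k) + y) (cong (Qpow i) (+suc-1≡+ k)) (cong (Qpow i) (++1≡+suc (suc k)))

-- ∑ₖ weight k · a k · b k is the inner product over ℤ of the even extensions of a and b,
-- for which Q₊ is self-adjoint up to a boundary term.
weight : ℕ → ℤ
weight zero    = 1ℤ
weight (suc _) = + 2

Q₊-Green : ∀ (a b : ℕ → ℤ) N → sumTo (suc N) (λ k → weight k * (Q₊ a k * b k - a k * Q₊ b k))
                              ≡ + 2 * (a (suc N) * b N - a N * b (suc N))
Q₊-Green a b zero    = base (a 0) (a 1) (b 0) (b 1)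
  where
  base : ∀ a₀ a₁ b₀ b₁ → 0ℤ + 1ℤ * ((+ 2 * a₀ + + 2 * a₁) * b₀ - a₀ * (+ 2 * b₀ + + 2 * b₁))
                        ≡ + 2 * (a₁ * b₀ - a₀ * b₁)
  base = solve-∀
Q₊-Green a b (suc N) =
  trans (cong (_+ weight (suc N) * (Q₊ a (suc N) * b (suc N) - a (suc N) * Q₊ b (suc N))) (Q₊-Green a b N))
        (step (a N) (a (suc N)) (a (suc (suc N))) (b N) (b (suc N)) (b (suc (suc N))))
  where
  step : ∀ a₀ a₁ a₂ b₀ b₁ b₂ → + 2 * (a₁ * b₀ - a₀ * b₁) + + 2 * ((a₀ + + 2 * a₁ + a₂) * b₁ - a₁ * (b₀ + + 2 * b₁ + b₂))
                              ≡ + 2 * (a₂ * b₁ - a₁ * b₂)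
  step = solve-∀

moment : ℕ → ℕ → ℕ → ℤ
moment M i j = sumTo M (λ k → weight k * (Qpow i (+ k) * Qpow j (+ k)))

moment-shift : ∀ N i j → i < N → j < N → moment (suc N) (suc i) j ≡ moment (suc N) i (suc j)
moment-shift N i j i<N j<N = ℤₚ.i-j≡0⇒i≡j _ _ (begin
  moment (suc N) (suc i) j - moment (suc N) i (suc j)
    ≡⟨ sumTo-− (suc N) (λ k → weight k * (Qpow (suc i) (+ k) * b k)) (λ k → weight k * (a k * Qpow (suc j) (+ k))) ⟨
  sumTo (suc N) (λ k → weight k * (Qpow (suc i) (+ k) * b k) - weight k * (a k * Qpow (suc j) (+ k)))
    ≡⟨ sumTo-cong (suc N) (λ k _ → trans (cong₂ (λ x y → weight k * (x * b k) - weight k * (a k * y)) (Qpow-suc i k) (Qpow-suc j k))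
                                         (pull-weight (weight k) (Q₊ a k) (b k) (a k) (Q₊ b k))) ⟩
  sumTo (suc N) (λ k → weight k * (Q₊ a k * b k - a k * Q₊ b k))
    ≡⟨ Q₊-Green a b N ⟩
  + 2 * (a (suc N) * b N - a N * b (suc N))
    ≡⟨ cong₂ (λ x y → + 2 * (a (suc N) * x - y * b (suc N))) (Qpow-support j (+ N) j<N) (Qpow-support i (+ N) i<N) ⟩
  + 2 * (a (suc N) * 0ℤ - 0ℤ * b (suc N))
    ≡⟨ vanish (a (suc N)) (b (suc N)) ⟩
  0ℤ
    ∎)
  where
  open ≡-Reasoning
  a b : ℕ → ℤ
  a k = Qpow i (+ k)
  b k = Qpow j (+ k)
  pull-weight : ∀ w x y z u → w * (x * y) - w * (z * u) ≡ w * (x * y - z * u)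
  pull-weight = solve-∀
  vanish : ∀ x y → + 2 * (x * 0ℤ - 0ℤ * y) ≡ 0ℤ
  vanish = solve-∀

moment-zero : ∀ M j → moment (suc M) 0 j ≡ central j
moment-zero M j = begin
  moment (suc M) 0 j
    ≡⟨ sumTo-suc M (λ k → weight k * (Qpow 0 (+ k) * Qpow j (+ k))) ⟩
  1ℤ * (1ℤ * central j) + sumTo M (λ k → + 2 * (0ℤ * Qpow j (+ suc k)))
    ≡⟨ cong₂ _+_ (trans (ℤₚ.*-identityˡ (1ℤ * central j)) (ℤₚ.*-identityˡ (central j)))
                 (sumTo-zero M (λ k _ → trans (cong (+ 2 *_) (ℤₚ.*-zeroˡ (Qpow j (+ suc k)))) (ℤₚ.*-zeroʳ (+ 2)))) ⟩
  central j + 0ℤ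
    ≡⟨ ℤₚ.+-identityʳ (central j) ⟩
  central j
    ∎
  where open ≡-Reasoning

central-moment : ∀ i j M → i ℕ.+ j < M → moment (suc M) i j ≡ central (i ℕ.+ j)
central-moment zero    j M _       = moment-zero M j
central-moment (suc i) j M i+j<M =
  trans (moment-shift M i j (ℕₚ.<-trans (ℕₚ.n<1+n i) (ℕₚ.≤-<-trans (ℕₚ.m≤m+n (suc i) j) i+j<M))
                            (ℕₚ.≤-<-trans (ℕₚ.m≤n+m j (suc i)) i+j<M))
        (trans (central-moment i (suc j) M (subst (_< M) (sym (ℕₚ.+-suc i j)) i+j<M))
               (cong central (ℕₚ.+-suc i j)))

prodFin-cong : ∀ {n} {f g : Fin n → ℤ} → (∀ i → f i ≡ g i) → prodFin f ≡ prodFin g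
prodFin-cong {zero}  f≡g = refl
prodFin-cong {suc n} f≡g = cong₂ _*_ (f≡g zero) (prodFin-cong (f≡g ∘ suc))

prodFin-const : ∀ n a → prodFin {n} (λ _ → a) ≡ a ^ n
prodFin-const zero    a = refl
prodFin-const (suc n) a = cong (a *_) (prodFin-const n a)

central-sum : ∀ n (i c : Fin n) →
              central (toℕ i ℕ.+ toℕ c) ≡ sumFin {n} (λ k → Qpow (toℕ i) (+ toℕ k) * (weight (toℕ k) * Qpow (toℕ c) (+ toℕ k)))
central-sum n i c = sym (begin
  sumFin {n} (λ k → term (toℕ k))                    ≡⟨ sumFin-toℕ n term ⟩
  sumTo n term                                       ≡⟨ sumTo-zeroTail (suc n) n term beyond-n ⟨
  sumTo (suc n ℕ.+ n) term                           ≡⟨ sumTo-cong (suc n ℕ.+ n) (λ k _ →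
                                                          reorder (Qpow (toℕ i) (+ k)) (weight k) (Qpow (toℕ c) (+ k))) ⟩
  moment (suc (n ℕ.+ n)) (toℕ i) (toℕ c)             ≡⟨ central-moment (toℕ i) (toℕ c) (n ℕ.+ n)
                                                                       (ℕₚ.+-mono-< (toℕ<n i) (toℕ<n c)) ⟩
  central (toℕ i ℕ.+ toℕ c)                          ∎)
  where
  open ≡-Reasoning
  term : ℕ → ℤ
  term k = Qpow (toℕ i) (+ k) * (weight k * Qpow (toℕ c) (+ k))
  beyond-n : ∀ k → n ≤ k → term k ≡ 0ℤ
  beyond-n k n≤k = trans (cong (_* (weight k * Qpow (toℕ c) (+ k))) (Qpow-support (toℕ i) (+ k) (ℕₚ.<-≤-trans (toℕ<n i) n≤k)))
                         (ℤₚ.*-zeroˡ (weight k * Qpow (toℕ c) (+ k)))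
  reorder : ∀ a w b → a * (w * b) ≡ w * (a * b)
  reorder = solve-∀

Hankel-central : ∀ n → Hankel (suc n) central ≡ (+ 2) ^ n
Hankel-central n = begin
  Hankel (suc n) central
    ≡⟨ det-unitriangular-* (suc n) (λ i k → Qpow (toℕ i) (+ toℕ k)) U (λ i j → central (toℕ i ℕ.+ toℕ j))
                           (λ i → Qpow-top (toℕ i))
                           (λ i k i<k → Qpow-support (toℕ i) (+ toℕ k) i<k) (central-sum (suc n)) ⟩
  det (suc n) U
    ≡⟨ det-upperTriangular (suc n) U (λ r c c<r → trans (cong (weight (toℕ r) *_) (Qpow-support (toℕ c) (+ toℕ r) c<r))
                                                       (ℤₚ.*-zeroʳ (weight (toℕ r)))) ⟩
  prodFin {suc n} (λ i → U i i)
    ≡⟨ prodFin-cong {suc n} (λ i → trans (cong (weight (toℕ i) *_) (Qpow-top (toℕ i))) (ℤₚ.*-identityʳ (weight (toℕ i)))) ⟩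
  prodFin {suc n} (λ i → weight (toℕ i))
    ≡⟨ trans (ℤₚ.*-identityˡ (prodFin {n} (λ _ → + 2))) (prodFin-const n (+ 2)) ⟩
  (+ 2) ^ n
    ∎
  where
  open ≡-Reasoning
  U : Mat (suc n)
  U k c = weight (toℕ k) * Qpow (toℕ c) (+ toℕ k)

-- Reduction modulo 3

Q-cong : ∀ a {f g : ℤ → ℤ} → (∀ k → f k ≡ g k) → ∀ k → Q a f k ≡ Q a g k
Q-cong a f≡g k = cong₂ _+_ (cong₂ (λ x y → x + + 2 * y) (f≡g (k - a)) (f≡g k)) (f≡g (k + a))

Q-cong-mod : ∀ {m} a {f g : ℤ → ℤ} → (∀ k → f k ≡ g k mod m) → ∀ k → Q a f k ≡ Q a g k mod m
Q-cong-mod a f≡g k = +-cong-mod (+-cong-mod (f≡g (k - a)) (*-cong-mod (≡⇒≡-mod {a = + 2} refl) (f≡g k))) (f≡g (k + a))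

Qⁿ-+ : ∀ m n f k → Qⁿ (m ℕ.+ n) f k ≡ Qⁿ m (Qⁿ n f) k
Qⁿ-+ zero    n f k = refl
Qⁿ-+ (suc m) n f k = Q-cong 1ℤ (Qⁿ-+ m n f) k

Q-at : ∀ a f k {l r} → k - a ≡ l → k + a ≡ r → Q a f k ≡ f l + + 2 * f k + f r
Q-at a f k refl refl = refl

Q² : ∀ a g k → Q a (Q a g) k ≡ g (k - a - a) + + 4 * g (k - a) + + 6 * g k + + 4 * g (k + a) + g (k + a + a)
Q² a g k = begin
  Q a g (k - a) + + 2 * Q a g k + Q a g (k + a)
    ≡⟨ cong₂ (λ x y → x + + 2 * Q a g k + y) (Q-at a g (k - a) refl (cancel⁻ k a)) (Q-at a g (k + a) (cancel⁺ k a) refl) ⟩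
  (g (k - a - a) + + 2 * g (k - a) + g k) + + 2 * (g (k - a) + + 2 * g k + g (k + a)) + (g k + + 2 * g (k + a) + g (k + a + a))
    ≡⟨ collect (g (k - a - a)) (g (k - a)) (g k) (g (k + a)) (g (k + a + a)) ⟩
  g (k - a - a) + + 4 * g (k - a) + + 6 * g k + + 4 * g (k + a) + g (k + a + a)
    ∎
  where
  open ≡-Reasoning
  cancel⁻ : ∀ k a → k - a + a ≡ k
  cancel⁻ = solve-∀
  cancel⁺ : ∀ k a → k + a - a ≡ k
  cancel⁺ = solve-∀
  collect : ∀ a b c d e → (a + + 2 * b + c) + + 2 * (b + + 2 * c + d) + (c + + 2 * d + e)
                         ≡ a + + 4 * b + + 6 * c + + 4 * d + e
  collect = solve-∀

-- (x⁻ᵃ + 2 + xᵃ)³ = x⁻³ᵃ + 6x⁻²ᵃ + 15x⁻ᵃ + 20 + 15xᵃ + 6x²ᵃ + x³ᵃ, and 20 ≡ 2 modulo 3.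
Q³ : ∀ a f k → Q a (Q a (Q a f)) k ≡ Q (a + a + a) f k mod (+ 3)
Q³ a f k = ≡-mod-trans (≡⇒≡-mod expanded) (+-multiple-mod _ q)
  where
  open ≡-Reasoning
  q : ℤ
  q = + 2 * f (k - a - a) + + 5 * f (k - a) + + 6 * f k + + 5 * f (k + a) + + 2 * f (k + a + a)
  cancel⁻ : ∀ k a → k - a + a ≡ k
  cancel⁻ = solve-∀
  cancel⁺ : ∀ k a → k + a - a ≡ k
  cancel⁺ = solve-∀
  triple⁻ : ∀ k a → k - a - a - a ≡ k - (a + a + a)
  triple⁻ = solve-∀
  triple⁺ : ∀ k a → k + a + a + a ≡ k + (a + a + a)
  triple⁺ = solve-∀
  collect : ∀ m₃ m₂ m₁ z p₁ p₂ p₃ →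
    (m₃ + + 2 * m₂ + m₁) + + 4 * (m₂ + + 2 * m₁ + z) + + 6 * (m₁ + + 2 * z + p₁)
      + + 4 * (z + + 2 * p₁ + p₂) + (p₁ + + 2 * p₂ + p₃)
    ≡ m₃ + + 2 * z + p₃ + (+ 2 * m₂ + + 5 * m₁ + + 6 * z + + 5 * p₁ + + 2 * p₂) * + 3
  collect = solve-∀
  expanded : Q a (Q a (Q a f)) k ≡ Q (a + a + a) f k + q * + 3
  expanded = begin
    Q a (Q a (Q a f)) k
      ≡⟨ Q² a (Q a f) k ⟩
    Q a f (k - a - a) + + 4 * Q a f (k - a) + + 6 * Q a f k + + 4 * Q a f (k + a) + Q a f (k + a + a)
      ≡⟨ cong₂ _+_ (cong₂ _+_ (cong₂ (λ x y → x + + 4 * y + + 6 * Q a f k)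
                                     (Q-at a f (k - a - a) refl (cancel⁻ (k - a) a)) (Q-at a f (k - a) refl (cancel⁻ k a)))
                              (cong (+ 4 *_) (Q-at a f (k + a) (cancel⁺ k a) refl)))
                   (Q-at a f (k + a + a) (cancel⁺ (k + a) a) refl) ⟩
    (f (k - a - a - a) + + 2 * f (k - a - a) + f (k - a)) + + 4 * (f (k - a - a) + + 2 * f (k - a) + f k)
      + + 6 * (f (k - a) + + 2 * f k + f (k + a)) + + 4 * (f k + + 2 * f (k + a) + f (k + a + a))
      + (f (k + a) + + 2 * f (k + a + a) + f (k + a + a + a))
      ≡⟨ collect (f (k - a - a - a)) (f (k - a - a)) (f (k - a)) (f k) (f (k + a)) (f (k + a + a)) (f (k + a + a + a)) ⟩
    f (k - a - a - a) + + 2 * f k + f (k + a + a + a) + q * + 3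
      ≡⟨ cong₂ (λ x y → x + + 2 * f k + y + q * + 3) (cong f (triple⁻ k a)) (cong f (triple⁺ k a)) ⟩
    Q (a + a + a) f k + q * + 3
      ∎

Qⁿ-Frobenius : ∀ K f k → Qⁿ (3 ℕ.^ K) f k ≡ Q (+ (3 ℕ.^ K)) f k mod (+ 3)
Qⁿ-Frobenius zero    f k = ≡⇒≡-mod refl
Qⁿ-Frobenius (suc K) f k = begin
  Qⁿ (a ℕ.+ (a ℕ.+ (a ℕ.+ 0))) f k    ≡⟨ Qⁿ-+ a (a ℕ.+ (a ℕ.+ 0)) f k ⟩
  Qⁿ a (Qⁿ (a ℕ.+ (a ℕ.+ 0)) f) k     ≈⟨ Qⁿ-Frobenius K (Qⁿ (a ℕ.+ (a ℕ.+ 0)) f) k ⟩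
  Q A (Qⁿ (a ℕ.+ (a ℕ.+ 0)) f) k      ≈⟨ Q-cong-mod A (λ l → ≡-mod-trans (≡⇒≡-mod (Qⁿ-+ a (a ℕ.+ 0) f l))
                                                                           (Qⁿ-Frobenius K (Qⁿ (a ℕ.+ 0) f) l)) k ⟩
  Q A (Q A (Qⁿ (a ℕ.+ 0) f)) k        ≈⟨ Q-cong-mod A (Q-cong-mod A (λ l →
                                           ≡-mod-trans (≡⇒≡-mod (cong (λ n → Qⁿ n f l) (ℕₚ.+-identityʳ a)))
                                                       (Qⁿ-Frobenius K f l))) k ⟩
  Q A (Q A (Q A f)) k                 ≈⟨ Q³ A f k ⟩
  Q (A + A + A) f k                   ≡⟨ cong (λ s → Q (+ s) f k) (trans (ℕₚ.+-assoc a a a)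
                                                                      (cong (λ b → a ℕ.+ (a ℕ.+ b)) (sym (ℕₚ.+-identityʳ a)))) ⟩
  Q (+ (3 ℕ.^ suc K)) f k             ∎
  where
  open ≡-mod-Reasoning (+ 3)
  a : ℕ
  a = 3 ℕ.^ K
  A : ℤ
  A = + a

Q-at-0 : ∀ a g → Q a g 0ℤ ≡ g (- a) + + 2 * g 0ℤ + g a
Q-at-0 a g = Q-at a g 0ℤ (ℤₚ.+-identityˡ (- a)) (ℤₚ.+-identityˡ a)

Qpow-beyond⁻ : ∀ r a → r < a → Qpow r (- + a) ≡ 0ℤ
Qpow-beyond⁻ r a r<a = trans (Qpow-even r (+ a)) (Qpow-support r (+ a) r<a)

central-3^K+ : ∀ K r → r < 3 ℕ.^ K → central (3 ℕ.^ K ℕ.+ r) ≡ - central r mod (+ 3)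
central-3^K+ K r r<a = begin
  central (a ℕ.+ r)                                  ≡⟨ Qⁿ-+ a r δ₀ 0ℤ ⟩
  Qⁿ a (Qpow r) 0ℤ                                   ≈⟨ Qⁿ-Frobenius K (Qpow r) 0ℤ ⟩
  Q (+ a) (Qpow r) 0ℤ                                ≡⟨ Q-at-0 (+ a) (Qpow r) ⟩
  Qpow r (- + a) + + 2 * central r + Qpow r (+ a)    ≡⟨ cong₂ (λ x y → x + + 2 * central r + y)
                                                              (Qpow-beyond⁻ r a r<a) (Qpow-support r (+ a) r<a) ⟩
  0ℤ + + 2 * central r + 0ℤ                          ≡⟨ rearrange (central r) ⟩
  - central r + central r * + 3                      ≈⟨ +-multiple-mod (- central r) (central r) ⟩
  - central r                                        ∎
  where
  open ≡-mod-Reasoning (+ 3)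
  a : ℕ
  a = 3 ℕ.^ K
  rearrange : ∀ x → 0ℤ + + 2 * x + 0ℤ ≡ - x + x * + 3
  rearrange = solve-∀

central-2·3^K+ : ∀ K r → r < 3 ℕ.^ K → central (3 ℕ.^ K ℕ.+ (3 ℕ.^ K ℕ.+ r)) ≡ 0ℤ mod (+ 3)
central-2·3^K+ K r r<a = begin
  central (a ℕ.+ (a ℕ.+ r))                          ≡⟨ Qⁿ-+ a (a ℕ.+ r) δ₀ 0ℤ ⟩
  Qⁿ a (Qpow (a ℕ.+ r)) 0ℤ                           ≈⟨ Qⁿ-Frobenius K (Qpow (a ℕ.+ r)) 0ℤ ⟩
  Q A (Qpow (a ℕ.+ r)) 0ℤ                            ≈⟨ Q-cong-mod A (λ l → ≡-mod-trans (≡⇒≡-mod (Qⁿ-+ a r δ₀ l))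
                                                                                       (Qⁿ-Frobenius K (Qpow r) l)) 0ℤ ⟩
  Q A (Q A (Qpow r)) 0ℤ                              ≡⟨ Q² A (Qpow r) 0ℤ ⟩
  Qpow r (0ℤ - A - A) + + 4 * Qpow r (0ℤ - A) + + 6 * central r + + 4 * Qpow r (0ℤ + A) + Qpow r (0ℤ + A + A)
    ≡⟨ cong₂ _+_ (cong₂ _+_ (cong₂ (λ x y → x + + 4 * y + + 6 * central r)
                                   (trans (cong (Qpow r) (twice⁻ A)) (Qpow-beyond⁻ r (a ℕ.+ a) r<2a))
                                   (trans (cong (Qpow r) (ℤₚ.+-identityˡ (- A))) (Qpow-beyond⁻ r a r<a)))
                            (cong (+ 4 *_) (Qpow-support r A r<a)))
                 (Qpow-support r (A + A) r<2a) ⟩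
  0ℤ + + 4 * 0ℤ + + 6 * central r + + 4 * 0ℤ + 0ℤ     ≡⟨ rearrange (central r) ⟩
  0ℤ + (+ 2 * central r) * + 3                       ≈⟨ +-multiple-mod 0ℤ (+ 2 * central r) ⟩
  0ℤ                                                 ∎
  where
  open ≡-mod-Reasoning (+ 3)
  a : ℕ
  a = 3 ℕ.^ K
  A : ℤ
  A = + a
  r<2a : r < a ℕ.+ a
  r<2a = ℕₚ.<-≤-trans r<a (ℕₚ.m≤m+n a a)
  twice⁻ : ∀ A → 0ℤ - A - A ≡ - (A + A)
  twice⁻ = solve-∀
  rearrange : ∀ x → 0ℤ + + 4 * 0ℤ + + 6 * x + + 4 * 0ℤ + 0ℤ ≡ 0ℤ + (+ 2 * x) * + 3
  rearrange = solve-∀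

-- The partial products of P₃

δ : ℕ → ℕ → ℤ
δ p j with j ℕ.≟ p
... | yes _ = 1ℤ
... | no  _ = 0ℤ

δ-same : ∀ p → δ p p ≡ 1ℤ
δ-same p with p ℕ.≟ p
... | yes _  = refl
... | no p≢p = ⊥-elim (p≢p refl)

δ-diff : ∀ p j → j ≢ p → δ p j ≡ 0ℤ
δ-diff p j j≢p with j ℕ.≟ p
... | yes j≡p = ⊥-elim (j≢p j≡p)
... | no  _   = refl

sumTo-δ-≥ : ∀ N (h : ℕ → ℤ) p → N ≤ p → sumTo N (λ j → h j * δ p j) ≡ 0ℤ
sumTo-δ-≥ N h p N≤p = sumTo-zero N λ j j<N →
  trans (cong (h j *_) (δ-diff p j (ℕₚ.<⇒≢ (ℕₚ.<-≤-trans j<N N≤p)))) (ℤₚ.*-zeroʳ (h j))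

sumTo-δ-< : ∀ N (h : ℕ → ℤ) p → p < N → sumTo N (λ j → h j * δ p j) ≡ h p
sumTo-δ-< (suc N) h p p<1+N with ℕₚ.m≤n⇒m<n∨m≡n (ℕₚ.≤-pred p<1+N)
... | inj₁ p<N  = trans (cong₂ _+_ (sumTo-δ-< N h p p<N) (trans (cong (h N *_) (δ-diff p N (ℕₚ.>⇒≢ p<N))) (ℤₚ.*-zeroʳ (h N))))
                        (ℤₚ.+-identityʳ (h p))
... | inj₂ refl = trans (cong₂ _+_ (sumTo-δ-≥ p h p ℕₚ.≤-refl) (cong (h p *_) (δ-same p)))
                        (trans (ℤₚ.+-identityˡ (h p * 1ℤ)) (ℤₚ.*-identityʳ (h p)))

factor-δ : ∀ K j → factor K j ≡ δ 0 j - δ (3 ℕ.^ K) j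
factor-δ K j with j ℕ.≟ 0 | j ℕ.≟ 3 ℕ.^ K
... | yes refl | yes 0≡a  = ⊥-elim (ℕₚ.<⇒≢ (ℕₚ.m^n>0 3 K) 0≡a)
... | yes refl | no  _    = refl
... | no  _    | yes refl = refl
... | no  _    | no  _    = refl

⊛-factor : ∀ f K m → (f ⊛ factor K) m ≡ sumTo (suc m) (λ j → f (m ∸ j) * δ 0 j)
                                        - sumTo (suc m) (λ j → f (m ∸ j) * δ (3 ℕ.^ K) j)
⊛-factor f K m = begin
  sumTo (suc m) (λ i → f i * factor K (m ∸ i))
    ≡⟨ sumTo-reverse m (λ i → f i * factor K (m ∸ i)) ⟩
  sumTo (suc m) (λ j → f (m ∸ j) * factor K (m ∸ (m ∸ j)))
    ≡⟨ sumTo-cong (suc m) (λ j j≤m → trans (cong (λ i → f (m ∸ j) * factor K i) (ℕₚ.m∸[m∸n]≡n (ℕₚ.≤-pred j≤m)))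
                                          (trans (cong (f (m ∸ j) *_) (factor-δ K j)) (distrib (f (m ∸ j)) (δ 0 j) _))) ⟩
  sumTo (suc m) (λ j → f (m ∸ j) * δ 0 j - f (m ∸ j) * δ (3 ℕ.^ K) j)
    ≡⟨ sumTo-− (suc m) (λ j → f (m ∸ j) * δ 0 j) (λ j → f (m ∸ j) * δ (3 ℕ.^ K) j) ⟩
  sumTo (suc m) (λ j → f (m ∸ j) * δ 0 j) - sumTo (suc m) (λ j → f (m ∸ j) * δ (3 ℕ.^ K) j)
    ∎
  where
  open ≡-Reasoning
  distrib : ∀ x a b → x * (a - b) ≡ x * a - x * b
  distrib = solve-∀

⊛-factor-< : ∀ f K m → m < 3 ℕ.^ K → (f ⊛ factor K) m ≡ f m
⊛-factor-< f K m m<a =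
  trans (⊛-factor f K m)
        (trans (cong₂ _-_ (sumTo-δ-< (suc m) (λ j → f (m ∸ j)) 0 (s≤s z≤n))
                          (sumTo-δ-≥ (suc m) (λ j → f (m ∸ j)) (3 ℕ.^ K) m<a))
               (ℤₚ.+-identityʳ (f m)))

⊛-factor-≥ : ∀ f K m → 3 ℕ.^ K ≤ m → (f ⊛ factor K) m ≡ f m - f (m ∸ 3 ℕ.^ K)
⊛-factor-≥ f K m a≤m =
  trans (⊛-factor f K m)
        (cong₂ _-_ (sumTo-δ-< (suc m) (λ j → f (m ∸ j)) 0 (s≤s z≤n))
                   (sumTo-δ-< (suc m) (λ j → f (m ∸ j)) (3 ℕ.^ K) (s≤s a≤m)))

prodFactors-vanish : ∀ K m → 3 ℕ.^ K ≤ m → prodFactors K m ≡ 0ℤ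
prodFactors-vanish zero    (suc m) _   = refl
prodFactors-vanish (suc K) m       3a≤m =
  trans (⊛-factor-≥ (prodFactors K) K m a≤m)
        (cong₂ _-_ (prodFactors-vanish K m a≤m) (prodFactors-vanish K (m ∸ a) (ℕₚ.m+n≤o⇒m≤o∸n a 2a≤m)))
  where
  a : ℕ
  a = 3 ℕ.^ K
  2a≤m : a ℕ.+ a ≤ m
  2a≤m = ℕₚ.≤-trans (ℕₚ.+-monoʳ-≤ a (ℕₚ.m≤m+n a (a ℕ.+ 0))) 3a≤m
  a≤m : a ≤ m
  a≤m = ℕₚ.≤-trans (ℕₚ.m≤m+n a a) 2a≤m

prodFactors-suc-≥ : ∀ K m → 3 ℕ.^ K ≤ m → prodFactors (suc K) m ≡ - prodFactors K (m ∸ 3 ℕ.^ K)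
prodFactors-suc-≥ K m a≤m =
  trans (⊛-factor-≥ (prodFactors K) K m a≤m)
        (trans (cong (_- prodFactors K (m ∸ 3 ℕ.^ K)) (prodFactors-vanish K m a≤m)) (ℤₚ.+-identityˡ _))

m<n+o⇒m∸n<o : ∀ {m n o} → m < n ℕ.+ o → n ≤ m → m ∸ n < o
m<n+o⇒m∸n<o {m} {n} {o} m<n+o n≤m = subst (m ∸ n <_) (ℕₚ.m+n∸m≡n n o) (ℕₚ.∸-monoˡ-< m<n+o n≤m)

prodFactors≡central : ∀ K m → m < 3 ℕ.^ K → prodFactors K m ≡ central m mod (+ 3)
prodFactors≡central zero    zero    _      = ≡⇒≡-mod refl
prodFactors≡central zero    (suc m) (s≤s ())
prodFactors≡central (suc K) m       m<3a with m ℕ.<? 3 ℕ.^ K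
... | yes m<a = ≡-mod-trans (≡⇒≡-mod (⊛-factor-< (prodFactors K) K m m<a)) (prodFactors≡central K m m<a)
... | no  m≮a with m ∸ 3 ℕ.^ K ℕ.<? 3 ℕ.^ K
...   | yes r<a = begin
  prodFactors (suc K) m        ≡⟨ prodFactors-suc-≥ K m a≤m ⟩
  - prodFactors K r            ≈⟨ neg-cong-mod (prodFactors≡central K r r<a) ⟩
  - central r                  ≈⟨ central-3^K+ K r r<a ⟨
  central (a ℕ.+ r)            ≡⟨ cong central (ℕₚ.m+[n∸m]≡n a≤m) ⟩
  central m                    ∎
  where
  open ≡-mod-Reasoning (+ 3)
  a r : ℕ
  a = 3 ℕ.^ K
  r = m ∸ a
  a≤m : a ≤ m
  a≤m = ℕₚ.≮⇒≥ m≮a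
...   | no  r≮a = begin
  prodFactors (suc K) m            ≡⟨ prodFactors-suc-≥ K m a≤m ⟩
  - prodFactors K r                ≡⟨ cong -_ (prodFactors-vanish K r a≤r) ⟩
  0ℤ                               ≈⟨ central-2·3^K+ K (r ∸ a) s<a ⟨
  central (a ℕ.+ (a ℕ.+ (r ∸ a)))  ≡⟨ cong (λ n → central (a ℕ.+ n)) (ℕₚ.m+[n∸m]≡n a≤r) ⟩
  central (a ℕ.+ r)                ≡⟨ cong central (ℕₚ.m+[n∸m]≡n a≤m) ⟩
  central m                        ∎
  where
  open ≡-mod-Reasoning (+ 3)
  a r : ℕ
  a = 3 ℕ.^ K
  r = m ∸ a
  a≤m : a ≤ m
  a≤m = ℕₚ.≮⇒≥ m≮a
  a≤r : a ≤ r
  a≤r = ℕₚ.≮⇒≥ r≮a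
  s<a : r ∸ a < a
  s<a = subst (r ∸ a <_) (ℕₚ.+-identityʳ a) (m<n+o⇒m∸n<o (m<n+o⇒m∸n<o m<3a a≤m) a≤r)

n<3^n : ∀ n → n < 3 ℕ.^ n
n<3^n zero    = s≤s z≤n
n<3^n (suc n) = ℕₚ.+-mono-≤ (ℕₚ.m^n>0 3 n) (ℕₚ.≤-trans (n<3^n n) (ℕₚ.m≤m+n (3 ℕ.^ n) _))

P₃≡central : ∀ m → P₃ m ≡ central m mod (+ 3)
P₃≡central m = prodFactors≡central (suc m) m (ℕₚ.<-≤-trans (n<3^n m) (ℕₚ.m≤m+n (3 ℕ.^ m) _))

theorem1p3 : (n : ℕ) → n ≥ 1 → (+ 3) ∣ (Hankel n P₃ - (-1ℤ) ^ (n ∸ 1))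
theorem1p3 (suc n) _ = ∣⇒∣ᵤ (divides-difference (begin
  Hankel (suc n) P₃        ≈⟨ det-cong-mod (suc n) (λ i j → P₃≡central (toℕ i ℕ.+ toℕ j)) ⟩
  Hankel (suc n) central   ≡⟨ Hankel-central n ⟩
  (+ 2) ^ n                ≈⟨ ^-cong-mod n (∣-difference (divides 1ℤ refl)) ⟩
  -1ℤ ^ n                  ∎))
  where open ≡-mod-Reasoning (+ 3)
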